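{- Let $G$ be a finite group, $H$ a subgroup with $[G:H]\geq 3$, and $S\subset G$ a nonempty subset with $S\cap H$ symmetric. Then the pair graph $\mathcal{G}(G,H,S)$ is not vertex transitive.
   Context: A subset $X\subset G$ is symmetric if $X^{ -1}=X$. The group-subgroup pair graph $\mathcal{G}(G,H,S)$ is the undirected graph with vertex set $G$ whose edges are exactly the pairs $\{h,hs\}$ with $h\in H$, $s\in S$. A graph is vertex transitive if for any two vertices $x,y$ there is a graph automorphism mapping $x$ to $y$. -}

module Defs where

open import Level using (Level; _⊔_; suc)
open import Algebra.Bundles using (Group)
open import Data.Nat using (ℕ)
open import Data.Fin using (Fin)
open import Data.Product using (Σ; _×_; _,_; ∃)
open import Data.Sum using (_⊎_)
open import Relation.Nullary using (¬_)
open import Function.Bundles using (Inverse)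
import Relation.Binary.PropositionalEquality as ≡

module _ {c ℓ : Level} (G : Group c ℓ) where
  open Group G

  IsFiniteGroup : Set (c ⊔ ℓ)
  IsFiniteGroup = Σ ℕ λ n → Inverse (≡.setoid (Fin n)) setoid

  record IsSubgroup {p : Level} (H : Carrier → Set p) : Set (c ⊔ ℓ ⊔ p) where
    field
      ε-mem : H ε
      ∙-mem : ∀ {x y} → H x → H y → H (x ∙ y)
      ⁻¹-mem : ∀ {x} → H x → H (x ⁻¹)

  -- [G : H] ≥ 3 : there are at least three pairwise distinct left cosets gH
  -- (g₁H = g₂H iff g₁⁻¹ g₂ ∈ H).
  IndexAtLeast3 : {p : Level} → (Carrier → Set p) → Set (c ⊔ p)
  IndexAtLeast3 H = Σ Carrier λ g₁ → Σ Carrier λ g₂ → Σ Carrier λ g₃ →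
    ¬ H (g₁ ⁻¹ ∙ g₂) × ¬ H (g₁ ⁻¹ ∙ g₃) × ¬ H (g₂ ⁻¹ ∙ g₃)

  -- X ∩ H is symmetric: (X ∩ H)⁻¹ = X ∩ H.  Since H is closed under inverses,
  -- this is: x ∈ X ∩ H implies x⁻¹ ∈ X ∩ H.
  SymmetricIntersection : {p q : Level} → (Carrier → Set p) → (Carrier → Set q) → Set (c ⊔ p ⊔ q)
  SymmetricIntersection S H = ∀ x → S x → H x → S (x ⁻¹) × H (x ⁻¹)

  -- Adjacency of the group-subgroup pair graph 𝒢(G,H,S): vertex set G,
  -- undirected edges {h, h s} with h ∈ H, s ∈ S.
  PairAdj : {p q : Level} → (Carrier → Set p) → (Carrier → Set q) → Carrier → Carrier → Set (c ⊔ ℓ ⊔ p ⊔ q)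
  PairAdj H S x y =
      (H x × Σ Carrier λ s → S s × y ≈ x ∙ s)
    ⊎ (H y × Σ Carrier λ s → S s × x ≈ y ∙ s)

  IsGraphAut : {r : Level} → (Carrier → Carrier → Set r) → Inverse setoid setoid → Set (c ⊔ r)
  IsGraphAut Adj f = ∀ x y → (Adj x y → Adj (to x) (to y)) × (Adj (to x) (to y) → Adj x y)
    where open Inverse f

  VertexTransitive : {r : Level} → (Carrier → Carrier → Set r) → Set (c ⊔ ℓ ⊔ r)
  VertexTransitive Adj = ∀ x y → Σ (Inverse setoid setoid) λ f →
    IsGraphAut Adj f × Inverse.to f x ≈ y

-- By vertex transitivity every vertex has at least |S| neighbours, as ε has the neighbours s ∈ S.
-- Every edge has an endpoint in H, so the neighbours of x ∉ H are the y ∈ H with y⁻¹ x ∈ S, and a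
-- fixed y ∈ H is such a neighbour of at most |S| vertices x.  Double counting these pairs gives
-- |G ∖ H| |S| ≤ |H| |S|, while [G : H] ≥ 3 gives |G ∖ H| ≥ 2 |H| and |H| |S| ≥ 1.
-- Counting needs decidable membership in H and S, which is available under a double negation
-- since the goal is ⊥.
module Submission where

open import Defs
open import Level using (Level)
open import Algebra.Bundles using (Group)
import Algebra.Properties.Group as GroupProperties
open import Data.Empty using (⊥; ⊥-elim)
open import Data.Fin using (Fin; zero; suc)
open import Data.Fin.Properties using (∀-cons)
open import Data.Nat using (ℕ; zero; suc; _+_; _*_; _≤_; z≤n)
open import Data.Nat.Properties
  using (≤-refl; ≤-trans; ≤-reflexive; +-mono-≤; *-mono-≤; m≤m+n; m≤n+m;
         m+1+n≰m; *-identityˡ; *-monoˡ-≤; *-distribʳ-+; n≤0⇒n≡0; +-*-semiring; module ≤-Reasoning)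
open import Algebra.Properties.Semiring.Sum +-*-semiring
  using (sum; ∑-comm; ∑-permute; ∑-distrib-+; *-distribʳ-sum; sum-replicate-zero)
open import Data.Product using (Σ; _×_; _,_; proj₁; proj₂)
open import Data.Sum using (inj₁; inj₂)
open import Function.Base using (_∘_)
open import Function.Bundles using (Inverse)
import Function.Construct.Composition as Composition
import Function.Construct.Symmetry as Symmetry
open import Relation.Binary.Bundles using (Setoid)
open import Relation.Binary.Definitions using (_Respects_)
open import Relation.Nullary using (¬_; Dec; yes; no)
open import Relation.Nullary.Decidable using (map′; _×-dec_; ¬?; ¬¬-excluded-middle)
open import Relation.Unary using (Pred; Decidable; _⊆_)
import Relation.Binary.PropositionalEquality as ≡
open ≡ using (_≡_)

indicator : ∀ {a} {A : Set a} → Dec A → ℕ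
indicator (yes _) = 1
indicator (no _) = 0

indicator-mono : ∀ {a b} {A : Set a} {B : Set b} → (A → B) →
  (a? : Dec A) (b? : Dec B) → indicator a? ≤ indicator b?
indicator-mono _ (yes _) (yes _) = ≤-refl
indicator-mono f (yes a) (no ¬b) = ⊥-elim (¬b (f a))
indicator-mono _ (no _) _ = z≤n

indicator-disjoint : ∀ {a b c} {A : Set a} {B : Set b} {C : Set c} →
  (A → C) → (B → C) → (A → B → ⊥) →
  (a? : Dec A) (b? : Dec B) (c? : Dec C) → indicator a? + indicator b? ≤ indicator c?
indicator-disjoint _ _ disjoint (yes a) (yes b) _ = ⊥-elim (disjoint a b)
indicator-disjoint A⇒C _ _ (yes a) (no _) c? = indicator-mono A⇒C (yes a) c?
indicator-disjoint _ B⇒C _ (no _) b? c? = indicator-mono B⇒C b? c?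

sum-mono-≤ : ∀ {n} {f g : Fin n → ℕ} → (∀ i → f i ≤ g i) → sum f ≤ sum g
sum-mono-≤ {zero} f≤g = z≤n
sum-mono-≤ {suc n} f≤g = +-mono-≤ (f≤g zero) (sum-mono-≤ (f≤g ∘ suc))

term≤sum : ∀ {n} (f : Fin n → ℕ) i → f i ≤ sum f
term≤sum f zero = m≤m+n _ _
term≤sum f (suc i) = ≤-trans (term≤sum (f ∘ suc) i) (m≤n+m _ _)

¬¬-∀-Fin : ∀ {n q} {Q : Fin n → Set q} → (∀ i → ¬ ¬ Q i) → ¬ ¬ (∀ i → Q i)
¬¬-∀-Fin {zero} ¬¬Q k = k λ ()
¬¬-∀-Fin {suc n} ¬¬Q k =
  ¬¬Q zero λ Q₀ → ¬¬-∀-Fin (¬¬Q ∘ suc) λ Qₛ → k (∀-cons Q₀ Qₛ)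

1≤m⇒m+m≰m : ∀ {m} → 1 ≤ m → ¬ (m + m ≤ m)
1≤m⇒m+m≰m {suc m} _ = m+1+n≰m (suc m)

module FiniteCount {a ℓ} {A : Setoid a ℓ} {n : ℕ} (enum : Inverse (≡.setoid (Fin n)) A) where
  open Setoid A
  open Inverse enum using (to; from; strictlyInverseˡ)

  ∑ : (Carrier → ℕ) → ℕ
  ∑ f = sum (f ∘ to)

  count : ∀ {p} {P : Pred Carrier p} → Decidable P → ℕ
  count P? = ∑ (indicator ∘ P?)

  ∑-mono-≤ : {f g : Carrier → ℕ} → (∀ x → f x ≤ g x) → ∑ f ≤ ∑ g
  ∑-mono-≤ f≤g = sum-mono-≤ (f≤g ∘ to)

  ¬¬-decidable : ∀ {p} {P : Pred Carrier p} → P Respects _≈_ → ¬ ¬ Decidable P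
  ¬¬-decidable {P = P} P-resp k =
    ¬¬-∀-Fin {Q = Dec ∘ P ∘ to} (λ _ → ¬¬-excluded-middle) λ P∘to? →
    k λ x → map′ (P-resp (strictlyInverseˡ x)) (P-resp (sym (strictlyInverseˡ x))) (P∘to? (from x))

  module _ {p q} {P : Pred Carrier p} {Q : Pred Carrier q} (P? : Decidable P) (Q? : Decidable Q) where

    count-≤-via : (σ : Inverse A A) → Q Respects _≈_ → (∀ x → P x → Q (Inverse.to σ x)) →
      count P? ≤ count Q?
    count-≤-via σ Q-resp P⇒Qσ = begin
      sum (indicator ∘ P? ∘ to)         ≤⟨ sum-mono-≤ pointwise ⟩
      sum (indicator ∘ Q? ∘ to ∘ π′)    ≡⟨ ∑-permute (indicator ∘ Q? ∘ to) π ⟨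
      sum (indicator ∘ Q? ∘ to)         ∎
      where
      open ≤-Reasoning
      π = Composition.inverse (Composition.inverse enum σ) (Symmetry.inverse enum)
      π′ = Inverse.to π
      pointwise : ∀ i → indicator (P? (to i)) ≤ indicator (Q? (to (π′ i)))
      pointwise i = indicator-mono (Q-resp (sym (strictlyInverseˡ _)) ∘ P⇒Qσ (to i))
        (P? (to i)) (Q? (to (π′ i)))

  module _ {p} {P : Pred Carrier p} (P? : Decidable P) where

    count-pos : P Respects _≈_ → ∀ {x} → P x → 1 ≤ count P?
    count-pos P-resp {x} Px =
      ≤-trans (indicator-mono (λ _ → P-resp (sym (strictlyInverseˡ x)) Px) (yes Px) (P? (to (from x))))
              (term≤sum (indicator ∘ P? ∘ to) (from x))

    count-empty : (∀ x → ¬ P x) → count P? ≡ 0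
    count-empty ¬P = n≤0⇒n≡0 (≤-trans (∑-mono-≤ nowhere) (≤-reflexive (sum-replicate-zero n)))
      where
      nowhere : ∀ x → indicator (P? x) ≤ 0
      nowhere x = indicator-mono (¬P x) (P? x) (no λ ())

  count-disjoint : ∀ {p q r} {P : Pred Carrier p} {Q : Pred Carrier q} {R : Pred Carrier r}
    (P? : Decidable P) (Q? : Decidable Q) (R? : Decidable R) →
    P ⊆ R → Q ⊆ R → (∀ {x} → P x → Q x → ⊥) → count P? + count Q? ≤ count R?
  count-disjoint P? Q? R? P⊆R Q⊆R disjoint = ≤-trans
    (≤-reflexive (≡.sym (∑-distrib-+ (indicator ∘ P? ∘ to) (indicator ∘ Q? ∘ to))))
    (∑-mono-≤ λ x → indicator-disjoint P⊆R Q⊆R disjoint (P? x) (Q? x) (R? x))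

  double-count : ∀ {p q r} {P : Pred Carrier p} {Q : Pred Carrier q} {R : Carrier → Carrier → Set r}
    (P? : Decidable P) (Q? : Decidable Q) (R? : ∀ x y → Dec (R x y)) (c : ℕ) →
    (∀ x → P x → c ≤ count (R? x)) →
    (∀ y → Q y → count (λ x → R? x y) ≤ c) →
    (∀ x y → R x y → Q y) →
    count P? * c ≤ count Q? * c
  double-count {Q = Q} P? Q? R? c out-degree in-degree R⊆Q = begin
    count P? * c                     ≡⟨ *-distribʳ-sum c (indicator ∘ P? ∘ to) ⟩
    ∑ (λ x → indicator (P? x) * c)   ≤⟨ ∑-mono-≤ (λ x → below (P? x) (out-degree x)) ⟩
    ∑ (λ x → count (R? x))           ≡⟨ ∑-comm (λ i j → indicator (R? (to i) (to j))) ⟩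
    ∑ (λ y → count (λ x → R? x y))   ≤⟨ ∑-mono-≤ (λ y → above (Q? y) (in-degree y) (no-in-degree y)) ⟩
    ∑ (λ y → indicator (Q? y) * c)   ≡⟨ *-distribʳ-sum c (indicator ∘ Q? ∘ to) ⟨
    count Q? * c                     ∎
    where
    open ≤-Reasoning
    below : ∀ {s} {S : Set s} {m} (s? : Dec S) → (S → c ≤ m) → indicator s? * c ≤ m
    below (yes s) c≤m = ≤-trans (≤-reflexive (*-identityˡ c)) (c≤m s)
    below (no _) _ = z≤n
    above : ∀ {s} {S : Set s} {m} (s? : Dec S) → (S → m ≤ c) → (¬ S → m ≡ 0) → m ≤ indicator s? * c
    above (yes s) m≤c _ = ≤-trans (m≤c s) (≤-reflexive (≡.sym (*-identityˡ c)))
    above (no ¬s) _ m≡0 = ≤-reflexive (m≡0 ¬s)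
    no-in-degree : ∀ y → ¬ Q y → count (λ x → R? x y) ≡ 0
    no-in-degree y ¬Qy = count-empty (λ x → R? x y) (λ x → ¬Qy ∘ R⊆Q x y)

module _ {c ℓ} (G : Group c ℓ) where
  open Group G
  open GroupProperties G using (\\-leftDividesˡ; \\-leftDividesʳ)

  translation : Carrier → Inverse setoid setoid
  translation g = record
    { to = g ∙_
    ; from = g ⁻¹ ∙_
    ; to-cong = ∙-congˡ
    ; from-cong = ∙-congˡ
    ; inverse = (λ {x} y≈ → trans (∙-congˡ y≈) (\\-leftDividesˡ g x))
              , (λ {x} y≈ → trans (∙-congˡ y≈) (\\-leftDividesʳ g x))
    }

module LeftCosets {c ℓ p} (G : Group c ℓ) {H : Pred (Group.Carrier G) p}
  (H-resp : H Respects Group._≈_ G) (H-sub : IsSubgroup G H) where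
  open Group G
  open GroupProperties G using (\\-leftDividesˡ; \\-leftDividesʳ; ⁻¹-anti-homo-∙; ⁻¹-involutive)
  open IsSubgroup H-sub
  open import Relation.Binary.Reasoning.Setoid setoid

  infix 4 _∼_
  _∼_ : Carrier → Carrier → Set p
  x ∼ y = H (x ⁻¹ ∙ y)

  ∼-sym : ∀ {x y} → x ∼ y → y ∼ x
  ∼-sym {x} {y} x∼y = H-resp inverse-of (⁻¹-mem x∼y)
    where
    inverse-of : (x ⁻¹ ∙ y) ⁻¹ ≈ y ⁻¹ ∙ x
    inverse-of = begin
      (x ⁻¹ ∙ y) ⁻¹     ≈⟨ ⁻¹-anti-homo-∙ (x ⁻¹) y ⟩
      y ⁻¹ ∙ x ⁻¹ ⁻¹    ≈⟨ ∙-congˡ (⁻¹-involutive x) ⟩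
      y ⁻¹ ∙ x          ∎

  ∼-trans : ∀ {x y z} → x ∼ y → y ∼ z → x ∼ z
  ∼-trans {x} {y} {z} x∼y y∼z = H-resp product (∙-mem x∼y y∼z)
    where
    product : (x ⁻¹ ∙ y) ∙ (y ⁻¹ ∙ z) ≈ x ⁻¹ ∙ z
    product = trans (assoc _ _ _) (∙-congˡ (\\-leftDividesˡ y z))

  ∼-translate : ∀ g {x y} → g ∙ x ∼ g ∙ y → x ∼ y
  ∼-translate g {x} {y} = H-resp (begin
    (g ∙ x) ⁻¹ ∙ (g ∙ y)     ≈⟨ ∙-congʳ (⁻¹-anti-homo-∙ g x) ⟩
    x ⁻¹ ∙ g ⁻¹ ∙ (g ∙ y)    ≈⟨ assoc _ _ _ ⟩
    x ⁻¹ ∙ (g ⁻¹ ∙ (g ∙ y))  ≈⟨ ∙-congˡ (\\-leftDividesʳ g y) ⟩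
    x ⁻¹ ∙ y                 ∎)

  coset-outside : ∀ {a x} → ¬ H a → a ∼ x → ¬ H x
  coset-outside {a} {x} a∉H a∼x x∈H =
    a∉H (H-resp (⁻¹-involutive a) (⁻¹-mem (H-resp cancel (∙-mem a∼x (⁻¹-mem x∈H)))))
    where
    cancel : (a ⁻¹ ∙ x) ∙ x ⁻¹ ≈ a ⁻¹
    cancel = trans (assoc _ _ _) (trans (∙-congˡ (inverseʳ x)) (identityʳ _))

  module _ {n} (enum : Inverse (≡.setoid (Fin n)) setoid) (H? : Decidable H) where
    open FiniteCount enum

    coset? : ∀ g → Decidable (g ∼_)
    coset? g x = H? (g ⁻¹ ∙ x)

    count-≤-count-coset : ∀ g → count H? ≤ count (coset? g)
    count-≤-count-coset g = count-≤-via H? (coset? g) (translation G g)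
      (H-resp ∘ ∙-congˡ) (λ x → H-resp (sym (\\-leftDividesʳ g x)))

    -- The cosets a H and b H of a = g₁⁻¹ g₂, b = g₁⁻¹ g₃ are disjoint and miss H.
    index≥3⇒∣H∣+∣H∣≤∣Hᶜ∣ : IndexAtLeast3 G H → count H? + count H? ≤ count (¬? ∘ H?)
    index≥3⇒∣H∣+∣H∣≤∣Hᶜ∣ (g₁ , g₂ , g₃ , g₁≁g₂ , g₁≁g₃ , g₂≁g₃) = ≤-trans
      (+-mono-≤ (count-≤-count-coset a) (count-≤-count-coset b))
      (count-disjoint (coset? a) (coset? b) (¬? ∘ H?) (coset-outside g₁≁g₂) (coset-outside g₁≁g₃)
        λ a∼x b∼x → g₂≁g₃ (∼-translate (g₁ ⁻¹) (∼-trans a∼x (∼-sym b∼x))))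
      where
      a = g₁ ⁻¹ ∙ g₂
      b = g₁ ⁻¹ ∙ g₃

module PairGraph {c ℓ p q} (G : Group c ℓ)
  {H : Pred (Group.Carrier G) p} {S : Pred (Group.Carrier G) q}
  (H-resp : H Respects Group._≈_ G) (S-resp : S Respects Group._≈_ G) (ε∈H : H (Group.ε G)) where
  open Group G
  open GroupProperties G using (\\-leftDividesʳ)

  ε-adjacent : ∀ {s} → S s → PairAdj G H S ε s
  ε-adjacent {s} s∈S = inj₁ (ε∈H , s , s∈S , sym (identityˡ s))

  adjacent-outside : ∀ {x y} → ¬ H x → PairAdj G H S x y → H y × S (y ⁻¹ ∙ x)
  adjacent-outside x∉H (inj₁ (x∈H , _)) = ⊥-elim (x∉H x∈H)
  adjacent-outside {x} {y} _ (inj₂ (y∈H , s , s∈S , x≈ys)) =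
    y∈H , S-resp (sym (trans (∙-congˡ x≈ys) (\\-leftDividesʳ y s))) s∈S

  module _ {n} (enum : Inverse (≡.setoid (Fin n)) setoid) (H? : Decidable H) (S? : Decidable S) where
    open FiniteCount enum

    -- For x ∉ H, the y with link? x y are exactly the neighbours of x.
    link? : ∀ x y → Dec (H y × S (y ⁻¹ ∙ x))
    link? x y = H? y ×-dec S? (y ⁻¹ ∙ x)

    vertexTransitive⇒∣S∣≤out-degree : VertexTransitive G (PairAdj G H S) →
      ∀ x → ¬ H x → count S? ≤ count (link? x)
    vertexTransitive⇒∣S∣≤out-degree vt x x∉H with vt ε x
    ... | σ , σ-aut , σε≈x = count-≤-via S? (link? x) σ link-resp λ s s∈S →
      let σs∈H , σs⁻¹σε∈S = adjacent-outside (x∉H ∘ H-resp σε≈x) (proj₁ (σ-aut ε s) (ε-adjacent s∈S))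
      in σs∈H , S-resp (∙-congˡ σε≈x) σs⁻¹σε∈S
      where
      link-resp : ∀ {y y′} → y ≈ y′ → H y × S (y ⁻¹ ∙ x) → H y′ × S (y′ ⁻¹ ∙ x)
      link-resp y≈y′ (y∈H , y⁻¹x∈S) = H-resp y≈y′ y∈H , S-resp (∙-congʳ (⁻¹-cong y≈y′)) y⁻¹x∈S

    in-degree≤∣S∣ : ∀ y → count (λ x → link? x y) ≤ count S?
    in-degree≤∣S∣ y = count-≤-via (λ x → link? x y) S? (translation G (y ⁻¹)) S-resp (λ _ → proj₂)

    vertexTransitive⇒∣Hᶜ∣*∣S∣≤∣H∣*∣S∣ : VertexTransitive G (PairAdj G H S) →
      count (¬? ∘ H?) * count S? ≤ count H? * count S?
    vertexTransitive⇒∣Hᶜ∣*∣S∣≤∣H∣*∣S∣ vt = double-count (¬? ∘ H?) H? link? (count S?)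
      (vertexTransitive⇒∣S∣≤out-degree vt) (λ y _ → in-degree≤∣S∣ y) (λ _ _ → proj₁)

proposition3p8 : {c ℓ p q : Level} (G : Group c ℓ) → IsFiniteGroup G →
    (H : Group.Carrier G → Set p) →
    (∀ {x y} → Group._≈_ G x y → H x → H y) → IsSubgroup G H → IndexAtLeast3 G H →
    (S : Group.Carrier G → Set q) →
    (∀ {x y} → Group._≈_ G x y → S x → S y) →
    Σ (Group.Carrier G) S → SymmetricIntersection G S H →
    ¬ VertexTransitive G (PairAdj G H S)
proposition3p8 G (n , enum) H H-resp H-sub index≥3 S S-resp (s , s∈S) _ vt =
  ¬¬-decidable H-resp λ H? → ¬¬-decidable S-resp λ S? →
  let h = count H?
      k = count S?
      1≤hk : 1 ≤ h * k
      1≤hk = *-mono-≤ (count-pos H? H-resp ε-mem) (count-pos S? S-resp s∈S)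
  in 1≤m⇒m+m≰m 1≤hk (begin
    h * k + h * k          ≡⟨ *-distribʳ-+ k h h ⟨
    (h + h) * k            ≤⟨ *-monoˡ-≤ k (index≥3⇒∣H∣+∣H∣≤∣Hᶜ∣ enum H? index≥3) ⟩
    count (¬? ∘ H?) * k    ≤⟨ vertexTransitive⇒∣Hᶜ∣*∣S∣≤∣H∣*∣S∣ enum H? S? vt ⟩
    h * k                  ∎)
  where
  open FiniteCount enum
  open IsSubgroup H-sub using (ε-mem)
  open LeftCosets G H-resp H-sub using (index≥3⇒∣H∣+∣H∣≤∣Hᶜ∣)
  open PairGraph G H-resp S-resp ε-mem using (vertexTransitive⇒∣Hᶜ∣*∣S∣≤∣H∣*∣S∣)
  open ≤-Reasoning
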